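{- There is no even, non-binary delta-matroid $D=(E,\mathcal{F})$ with $\emptyset\in\mathcal{F}$ such that $w(D)=w(D\star A)$ for every $A\subseteq E$.
   Context: A delta-matroid is a pair $D=(E,\mathcal{F})$ with $E$ finite and $\mathcal{F}$ a nonempty collection of subsets of $E$ (feasible sets) such that for all $F_1,F_2\in\mathcal{F}$ and $x\in F_1\Delta F_2$ there is $y\in F_1\Delta F_2$ (possibly $y=x$) with $F_1\Delta\{x,y\}\in\mathcal{F}$. For $A\subseteq E$ the twist is $D\star A=(E,\{A\Delta X: X\in\mathcal{F}\})$. The width $w(D)$ is the difference between the maximum and the minimum cardinality of a feasible set. $D$ is even if all feasible sets have cardinalities of the same parity. For a symmetric matrix $A=(a_{vw})_{v,w\in E}$ over $GF(2)$ and $W\subseteq E$, let $A[W]=(a_{vw})_{v,w\in W}$ (with $A[\emptyset]$ regarded as invertible), and $D(A)=(E,\{W\subseteq E: A[W]\text{ is invertible}\})$. $D$ is binary if there exist $F\in\mathcal{F}$ and a symmetric binary matrix $A$ with $D=D(A)\star F$. -}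

module Defs where

open import Data.Nat using (ℕ; zero; suc; _∸_; _⊔_; _⊓_; _%_)
open import Data.Bool using (Bool; true; false; _xor_; _∧_; if_then_else_)
open import Data.Fin using (Fin; zero; suc; _≟_)
open import Data.Fin.Subset using (Subset; ⊥; ⁅_⁆; _∪_; _∈_; ∣_∣)
open import Data.Vec using (Vec; []; _∷_; zipWith; lookup)
open import Data.List using (List; []; _∷_; map; _++_; foldr)
open import Data.Product using (Σ; _×_; ∃)
open import Relation.Binary.PropositionalEquality using (_≡_)
open import Relation.Nullary using (¬_; does)

-- Ground set E = Fin n; subsets of E are Data.Fin.Subset n.
-- A set system F ⊆ 2^E is represented by its characteristic function.
SetSystem : ℕ → Set
SetSystem n = Subset n → Bool

_Δ_ : ∀ {n} → Subset n → Subset n → Subset n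
_Δ_ = zipWith _xor_

Feasible : ∀ {n} → SetSystem n → Subset n → Set
Feasible F X = F X ≡ true

IsDeltaMatroid : ∀ {n} → SetSystem n → Set
IsDeltaMatroid {n} F =
  ∃ (λ X → Feasible F X) ×
  ((F₁ F₂ : Subset n) → Feasible F F₁ → Feasible F F₂ →
     (x : Fin n) → x ∈ (F₁ Δ F₂) →
     Σ (Fin n) λ y → y ∈ (F₁ Δ F₂) × Feasible F (F₁ Δ (⁅ x ⁆ ∪ ⁅ y ⁆)))

-- twist D ⋆ A : feasible sets are A Δ X for X feasible; since Δ A is an
-- involution, Y = A Δ X is feasible in D ⋆ A iff A Δ Y is feasible in D.
twist : ∀ {n} → SetSystem n → Subset n → SetSystem n
twist F A Y = F (A Δ Y)

allSubsets : ∀ n → List (Subset n)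
allSubsets zero = [] ∷ []
allSubsets (suc n) = map (true ∷_) (allSubsets n) ++ map (false ∷_) (allSubsets n)

feasibleSizes : ∀ {n} → SetSystem n → List ℕ
feasibleSizes {n} F =
  foldr (λ X r → if F X then ∣ X ∣ ∷ r else r) [] (allSubsets n)

maxSize : ∀ {n} → SetSystem n → ℕ
maxSize F = foldr _⊔_ 0 (feasibleSizes F)

-- every subset has size ≤ n, so n is a neutral start for min on nonempty families
minSize : ∀ {n} → SetSystem n → ℕ
minSize {n} F = foldr _⊓_ n (feasibleSizes F)

width : ∀ {n} → SetSystem n → ℕ
width F = maxSize F ∸ minSize F

IsEven : ∀ {n} → SetSystem n → Set
IsEven {n} F = (X Y : Subset n) → Feasible F X → Feasible F Y →
  ∣ X ∣ % 2 ≡ ∣ Y ∣ % 2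

-- GF(2) arithmetic: Bool with xor as addition and ∧ as multiplication
sumGF2 : ∀ {n} → (Fin n → Bool) → Bool
sumGF2 {zero} f = false
sumGF2 {suc n} f = f zero xor sumGF2 (λ i → f (suc i))

Matrix : ℕ → Set
Matrix n = Fin n → Fin n → Bool

IsSymmetric : ∀ {n} → Matrix n → Set
IsSymmetric A = ∀ i j → A i j ≡ A j i

δ : ∀ {n} → Fin n → Fin n → Bool
δ i j = does (i ≟ j)

sumOver : ∀ {n} → Subset n → (Fin n → Bool) → Bool
sumOver W f = sumGF2 (λ j → lookup W j ∧ f j)

-- A[W] (the W×W principal submatrix, indexed by W) is invertible over GF(2):
-- there is a W×W matrix B (entries of B outside W×W are irrelevant)
-- with A[W] B = I and B A[W] = I.
PrincipalInvertible : ∀ {n} → Matrix n → Subset n → Set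
PrincipalInvertible {n} A W = Σ (Matrix n) λ B →
  ((i k : Fin n) → i ∈ W → k ∈ W → sumOver W (λ j → A i j ∧ B j k) ≡ δ i k) ×
  ((i k : Fin n) → i ∈ W → k ∈ W → sumOver W (λ j → B i j ∧ A j k) ≡ δ i k)

-- D is binary: ∃ feasible F₀ and symmetric binary A with D = D(A) ⋆ F₀,
-- i.e. X feasible in D iff (F₀ Δ X) feasible in D(A) iff A[F₀ Δ X] invertible.
IsBinary : ∀ {n} → SetSystem n → Set
IsBinary {n} F = Σ (Subset n) λ F₀ → Feasible F F₀ × Σ (Matrix n) λ A →
  IsSymmetric A ×
  ((X : Subset n) → Feasible F X → PrincipalInvertible A (F₀ Δ X)) ×
  ((X : Subset n) → PrincipalInvertible A (F₀ Δ X) → Feasible F X)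

-- Let r be the width of D. As ∅ is feasible in D and in every twist D ⋆ X with X feasible, the
-- width condition says that feasible sets are pairwise at distance |X Δ Y| ≤ r, while every
-- infeasible set is at distance > r from some feasible set; evenness, the exchange axiom and these
-- two distance conditions are preserved by twisting with a feasible set.
--
-- The feasible sets of size r behave like the bases of a matroid, and every feasible pair {a, b}
-- meets each of them. If {a, b} and {b, c} were feasible but {a, c} not, there would be a feasible
-- set of size r avoiding a and c (so containing b), and moving a feasible set of size r avoiding b
-- towards it by basis exchanges produces a feasible set of size r avoiding both b and c. So
-- "{a, b} is feasible" is an equivalence relation. Twisting by feasible sets then shows that adding
-- a feasible pair to a feasible set keeps it feasible, so the feasible sets are exactly the sets
-- meeting every equivalence class in an even number of elements. These are the sets W for which
-- A[W] is invertible over GF(2), where A is the adjacency matrix of the disjoint union of the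
-- complete graphs on the classes (then A[W]² = I); hence D = D(A) is binary.
module Submission where

open import Defs

open import Algebra.Bundles using (CommutativeMonoid; CommutativeRing)
open import Data.Bool using (Bool; true; false; not; _xor_; _∧_; if_then_else_)
import Data.Bool as Bool
open import Data.Bool.Properties
  using (xor-assoc; xor-comm; xor-identityˡ; xor-identityʳ; xor-same; true-xor; ¬-not; ∧-comm; ∧-zeroʳ;
         ∧-identityʳ; ∧-distribˡ-xor; ∧-distribʳ-xor; ∧-commutativeMonoid; xor-∧-commutativeRing)
open import Algebra.Properties.CommutativeSemigroup (CommutativeMonoid.commutativeSemigroup ∧-commutativeMonoid)
  using () renaming (x∙yz≈y∙xz to ∧-left-comm; x∙yz≈y∙zx to ∧-rotate)
open import Algebra.Properties.Semiring.Sum (CommutativeRing.semiring xor-∧-commutativeRing)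
  using (sum; sum-cong-≗; sum-replicate-zero; ∑-distrib-+; ∑-comm; *-distribˡ-sum)
open import Data.Fin using (Fin; zero; suc; _≟_)
open import Data.Fin.Properties using (any?)
open import Data.Fin.Subset using (Subset; ⊥; ⁅_⁆; _∪_; _∈_; ∣_∣)
open import Data.Fin.Subset.Properties
  using (∪-identityˡ; ∪-identityʳ; ∪-idem; ∣p∣≤n; ∣⊥∣≡0; ∣⁅x⁆∣≡1; nonempty?; Empty-unique)
open import Data.List using (List; []; _∷_; map; foldr)
open import Data.List.Membership.Propositional using () renaming (_∈_ to _∈ₗ_)
open import Data.List.Membership.Propositional.Properties using (∈-map⁺; ∈-++⁺ˡ; ∈-++⁺ʳ; foldr-selective)
open import Data.List.Properties using (foldr-preservesᵒ)
import Data.List.Relation.Unary.Any as Any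
open import Data.Nat using (ℕ; zero; suc; _+_; _∸_; _%_; _≤_; _≰_; _<_; s≤s; z≤n; parity)
open import Data.Nat.Induction using (<-wellFounded)
open import Data.Nat.Properties
  using (suc-injective; ≤-reflexive; ≤-trans; ≤-antisym; ≤-pred; n≤1+n; 1+n≰n; <⇒≱; n≤0⇒n≡0;
         m≤n⇒m<n∨m≡n; ∸-monoʳ-<; ⊔-sel; ⊓-sel; m≤n⇒m≤n⊔o; m≤n⇒m≤o⊔n; m≤n⇒m⊓o≤n; m≤n⇒o⊓m≤n)
open import Data.Parity.Base using (0ℙ; 1ℙ; _⁻¹) renaming (_+_ to _+ℙ_)
open import Data.Parity.Properties using (+-homo-+; ⁻¹-involutive; p≢p⁻¹; p+p≡0ℙ)
open import Data.Product using (Σ; ∃-syntax; _×_; _,_; proj₂)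
open import Data.Sum using (_⊎_; inj₁; inj₂; [_,_])
open import Data.Vec using ([]; _∷_; lookup)
open import Data.Vec.Properties
  using ([]=⇒lookup; lookup⇒[]=; lookup-zipWith; lookup-replicate;
         zipWith-assoc; zipWith-comm; zipWith-identityˡ; zipWith-identityʳ)
open import Function using (id; _∘_; _on_)
open import Induction.WellFounded using (Acc; acc)
import Relation.Binary.Construct.On as On
open import Relation.Binary.PropositionalEquality
  using (_≡_; _≢_; refl; sym; trans; cong; cong₂; subst; module ≡-Reasoning)
open import Relation.Binary.Structures using (IsEquivalence)
open import Relation.Nullary using (¬_; yes; no; contradiction)
open import Relation.Nullary.Decidable using (dec-true; dec-false; decidable-stable; ¬?; _×-dec_)

private
  variable
    n : ℕ

xor≡true⇒≡not : ∀ {a b} → a xor b ≡ true → b ≡ not a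
xor≡true⇒≡not {true}  {false} _ = refl
xor≡true⇒≡not {false} {true}  _ = refl

∧-≡true : ∀ {a b} → a ∧ b ≡ true → a ≡ true × b ≡ true
∧-≡true {true} {true} _ = refl , refl

δ-refl : (i : Fin n) → δ i i ≡ true
δ-refl i = dec-true (i ≟ i) refl

δ-≢ : {i j : Fin n} → i ≢ j → δ i j ≡ false
δ-≢ {i = i} {j} = dec-false (i ≟ j)

δ-sym : (i j : Fin n) → δ i j ≡ δ j i
δ-sym i j with i ≟ j
... | yes refl = sym (δ-refl i)
... | no i≢j   = sym (δ-≢ (i≢j ∘ sym))

-- Symmetric difference

Δ-assoc : (X Y Z : Subset n) → (X Δ Y) Δ Z ≡ X Δ (Y Δ Z)
Δ-assoc = zipWith-assoc xor-assoc

Δ-comm : (X Y : Subset n) → X Δ Y ≡ Y Δ X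
Δ-comm = zipWith-comm xor-comm

Δ-identityˡ : (X : Subset n) → ⊥ Δ X ≡ X
Δ-identityˡ = zipWith-identityˡ xor-identityˡ

Δ-identityʳ : (X : Subset n) → X Δ ⊥ ≡ X
Δ-identityʳ = zipWith-identityʳ xor-identityʳ

Δ-self : (X : Subset n) → X Δ X ≡ ⊥
Δ-self []      = refl
Δ-self (x ∷ X) = cong₂ _∷_ (xor-same x) (Δ-self X)

Δ-cancelˡ : (X Y : Subset n) → X Δ (X Δ Y) ≡ Y
Δ-cancelˡ X Y = begin
  X Δ (X Δ Y) ≡⟨ Δ-assoc X X Y ⟨
  (X Δ X) Δ Y ≡⟨ cong (_Δ Y) (Δ-self X) ⟩
  ⊥ Δ Y       ≡⟨ Δ-identityˡ Y ⟩
  Y           ∎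
  where open ≡-Reasoning

Δ-cancelʳ : (X Y : Subset n) → (X Δ Y) Δ Y ≡ X
Δ-cancelʳ X Y = begin
  (X Δ Y) Δ Y ≡⟨ Δ-assoc X Y Y ⟩
  X Δ (Y Δ Y) ≡⟨ cong (X Δ_) (Δ-self Y) ⟩
  X Δ ⊥       ≡⟨ Δ-identityʳ X ⟩
  X           ∎
  where open ≡-Reasoning

Δ-swapʳ : (X Y Z : Subset n) → (X Δ Y) Δ Z ≡ (X Δ Z) Δ Y
Δ-swapʳ X Y Z = begin
  (X Δ Y) Δ Z ≡⟨ Δ-assoc X Y Z ⟩
  X Δ (Y Δ Z) ≡⟨ cong (X Δ_) (Δ-comm Y Z) ⟩
  X Δ (Z Δ Y) ≡⟨ Δ-assoc X Z Y ⟨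
  (X Δ Z) Δ Y ∎
  where open ≡-Reasoning

Δ-translate : (A X Y : Subset n) → (A Δ X) Δ (A Δ Y) ≡ X Δ Y
Δ-translate A X Y = begin
  (A Δ X) Δ (A Δ Y) ≡⟨ cong (_Δ (A Δ Y)) (Δ-comm A X) ⟩
  (X Δ A) Δ (A Δ Y) ≡⟨ Δ-assoc X A (A Δ Y) ⟩
  X Δ (A Δ (A Δ Y)) ≡⟨ cong (X Δ_) (Δ-cancelˡ A Y) ⟩
  X Δ Y             ∎
  where open ≡-Reasoning

lookup-Δ : (X Y : Subset n) (i : Fin n) → lookup (X Δ Y) i ≡ lookup X i xor lookup Y i
lookup-Δ X Y i = lookup-zipWith _xor_ i X Y

lookup-⁅⁆ : (x y : Fin n) → lookup ⁅ x ⁆ y ≡ δ x y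
lookup-⁅⁆ zero    zero    = refl
lookup-⁅⁆ zero    (suc y) = lookup-replicate y false
lookup-⁅⁆ (suc x) zero    = refl
lookup-⁅⁆ (suc x) (suc y) = lookup-⁅⁆ x y

lookup-Δ⁅⁆-≢ : (X : Subset n) {x y : Fin n} → x ≢ y → lookup (X Δ ⁅ x ⁆) y ≡ lookup X y
lookup-Δ⁅⁆-≢ X {x} {y} x≢y = begin
  lookup (X Δ ⁅ x ⁆) y          ≡⟨ lookup-Δ X ⁅ x ⁆ y ⟩
  lookup X y xor lookup ⁅ x ⁆ y ≡⟨ cong (lookup X y xor_) (trans (lookup-⁅⁆ x y) (δ-≢ x≢y)) ⟩
  lookup X y xor false          ≡⟨ xor-identityʳ (lookup X y) ⟩
  lookup X y                    ∎
  where open ≡-Reasoning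

lookup-Δ⁅⁆-self : (X : Subset n) (x : Fin n) → lookup (X Δ ⁅ x ⁆) x ≡ not (lookup X x)
lookup-Δ⁅⁆-self X x = begin
  lookup (X Δ ⁅ x ⁆) x          ≡⟨ lookup-Δ X ⁅ x ⁆ x ⟩
  lookup X x xor lookup ⁅ x ⁆ x ≡⟨ cong (lookup X x xor_) (trans (lookup-⁅⁆ x x) (δ-refl x)) ⟩
  lookup X x xor true           ≡⟨ xor-comm (lookup X x) true ⟩
  true xor lookup X x           ≡⟨ true-xor (lookup X x) ⟩
  not (lookup X x)              ∎
  where open ≡-Reasoning

∉-∈⇒≢ : (X : Subset n) {x y : Fin n} → lookup X x ≡ false → lookup X y ≡ true → x ≢ y
∉-∈⇒≢ X x∉X y∈X refl = contradiction (trans (sym x∉X) y∈X) λ ()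

element-or-empty : (X : Subset n) → (∃[ x ] lookup X x ≡ true) ⊎ X ≡ ⊥
element-or-empty X with nonempty? X
... | yes (x , x∈X) = inj₁ (x , []=⇒lookup x∈X)
... | no X-empty    = inj₂ (Empty-unique X-empty)

∣Δ⁅⁆∣-∉ : (X : Subset n) (x : Fin n) → lookup X x ≡ false → ∣ X Δ ⁅ x ⁆ ∣ ≡ suc ∣ X ∣
∣Δ⁅⁆∣-∉ (false ∷ X) zero    _   = cong (suc ∘ ∣_∣) (Δ-identityʳ X)
∣Δ⁅⁆∣-∉ (true  ∷ X) (suc x) x∉X = cong suc (∣Δ⁅⁆∣-∉ X x x∉X)
∣Δ⁅⁆∣-∉ (false ∷ X) (suc x) x∉X = ∣Δ⁅⁆∣-∉ X x x∉X

∣Δ⁅⁆∣-∈ : (X : Subset n) (x : Fin n) → lookup X x ≡ true → suc ∣ X Δ ⁅ x ⁆ ∣ ≡ ∣ X ∣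
∣Δ⁅⁆∣-∈ (true  ∷ X) zero    _   = cong (suc ∘ ∣_∣) (Δ-identityʳ X)
∣Δ⁅⁆∣-∈ (true  ∷ X) (suc x) x∈X = cong suc (∣Δ⁅⁆∣-∈ X x x∈X)
∣Δ⁅⁆∣-∈ (false ∷ X) (suc x) x∈X = ∣Δ⁅⁆∣-∈ X x x∈X

pair : Fin n → Fin n → Subset n
pair x y = ⁅ x ⁆ Δ ⁅ y ⁆

pair-comm : (x y : Fin n) → pair x y ≡ pair y x
pair-comm x y = Δ-comm ⁅ x ⁆ ⁅ y ⁆

pair-self : (x : Fin n) → pair x x ≡ ⊥
pair-self x = Δ-self ⁅ x ⁆

pair-chain : (a b c : Fin n) → pair a b Δ pair b c ≡ pair a c
pair-chain a b c = trans (Δ-assoc ⁅ a ⁆ ⁅ b ⁆ (pair b c)) (cong (⁅ a ⁆ Δ_) (Δ-cancelˡ ⁅ b ⁆ ⁅ c ⁆))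

⁅⁆∪⁅⁆≡pair : {x y : Fin n} → x ≢ y → ⁅ x ⁆ ∪ ⁅ y ⁆ ≡ pair x y
⁅⁆∪⁅⁆≡pair {x = zero}  {zero}  x≢y = contradiction refl x≢y
⁅⁆∪⁅⁆≡pair {x = zero}  {suc y} _   = cong (true ∷_) (trans (∪-identityˡ ⁅ y ⁆) (sym (Δ-identityˡ ⁅ y ⁆)))
⁅⁆∪⁅⁆≡pair {x = suc x} {zero}  _   = cong (true ∷_) (trans (∪-identityʳ ⁅ x ⁆) (sym (Δ-identityʳ ⁅ x ⁆)))
⁅⁆∪⁅⁆≡pair {x = suc x} {suc y} x≢y = cong (false ∷_) (⁅⁆∪⁅⁆≡pair (x≢y ∘ cong suc))

Δpair-split : (X : Subset n) (x y : Fin n) → X Δ pair x y ≡ (X Δ ⁅ x ⁆) Δ ⁅ y ⁆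
Δpair-split X x y = sym (Δ-assoc X ⁅ x ⁆ ⁅ y ⁆)

lookup-Δpair-≢ : (X : Subset n) {x y z : Fin n} → x ≢ z → y ≢ z → lookup (X Δ pair x y) z ≡ lookup X z
lookup-Δpair-≢ X {x} {y} {z} x≢z y≢z = begin
  lookup (X Δ pair x y) z         ≡⟨ cong (λ S → lookup S z) (Δpair-split X x y) ⟩
  lookup ((X Δ ⁅ x ⁆) Δ ⁅ y ⁆) z ≡⟨ lookup-Δ⁅⁆-≢ (X Δ ⁅ x ⁆) y≢z ⟩
  lookup (X Δ ⁅ x ⁆) z           ≡⟨ lookup-Δ⁅⁆-≢ X x≢z ⟩
  lookup X z                      ∎
  where open ≡-Reasoning

lookup-Δpair-snd : (X : Subset n) {x y : Fin n} → x ≢ y → lookup (X Δ pair x y) y ≡ not (lookup X y)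
lookup-Δpair-snd X {x} {y} x≢y = begin
  lookup (X Δ pair x y) y         ≡⟨ cong (λ S → lookup S y) (Δpair-split X x y) ⟩
  lookup ((X Δ ⁅ x ⁆) Δ ⁅ y ⁆) y ≡⟨ lookup-Δ⁅⁆-self (X Δ ⁅ x ⁆) y ⟩
  not (lookup (X Δ ⁅ x ⁆) y)     ≡⟨ cong not (lookup-Δ⁅⁆-≢ X x≢y) ⟩
  not (lookup X y)                ∎
  where open ≡-Reasoning

lookup-pairΔpair : (a b c d z : Fin n) →
                   lookup (pair a b Δ pair c d) z ≡ (δ a z xor δ b z) xor (δ c z xor δ d z)
lookup-pairΔpair a b c d z = begin
  lookup (pair a b Δ pair c d) z                         ≡⟨ lookup-Δ (pair a b) (pair c d) z ⟩
  lookup (pair a b) z xor lookup (pair c d) z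
    ≡⟨ cong₂ _xor_ (lookup-Δ ⁅ a ⁆ ⁅ b ⁆ z) (lookup-Δ ⁅ c ⁆ ⁅ d ⁆ z) ⟩
  (lookup ⁅ a ⁆ z xor lookup ⁅ b ⁆ z) xor (lookup ⁅ c ⁆ z xor lookup ⁅ d ⁆ z)
    ≡⟨ cong₂ _xor_ (cong₂ _xor_ (lookup-⁅⁆ a z) (lookup-⁅⁆ b z)) (cong₂ _xor_ (lookup-⁅⁆ c z) (lookup-⁅⁆ d z)) ⟩
  (δ a z xor δ b z) xor (δ c z xor δ d z)                ∎
  where open ≡-Reasoning

pairΔpair-members : {a b c d y : Fin n} → lookup (pair a b Δ pair c d) y ≡ true →
                    (y ≡ a ⊎ y ≡ b) ⊎ (y ≡ c ⊎ y ≡ d)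
pairΔpair-members {a = a} {b} {c} {d} {y} y∈S with a ≟ y | b ≟ y | c ≟ y | d ≟ y
... | yes refl | _        | _        | _        = inj₁ (inj₁ refl)
... | no _     | yes refl | _        | _        = inj₁ (inj₂ refl)
... | no _     | no _     | yes refl | _        = inj₂ (inj₁ refl)
... | no _     | no _     | no _     | yes refl = inj₂ (inj₂ refl)
... | no a≢y   | no b≢y   | no c≢y   | no d≢y   = contradiction (trans (sym y∈S) y∉S) λ ()
  where
  y∉S : lookup (pair a b Δ pair c d) y ≡ false
  y∉S = trans (lookup-pairΔpair a b c d y)
              (cong₂ _xor_ (cong₂ _xor_ (δ-≢ a≢y) (δ-≢ b≢y)) (cong₂ _xor_ (δ-≢ c≢y) (δ-≢ d≢y)))

∣Δpair∣-∉∉ : (X : Subset n) {x y : Fin n} → x ≢ y → lookup X x ≡ false → lookup X y ≡ false →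
             ∣ X Δ pair x y ∣ ≡ 2 + ∣ X ∣
∣Δpair∣-∉∉ X {x} {y} x≢y x∉X y∉X = begin
  ∣ X Δ pair x y ∣         ≡⟨ cong ∣_∣ (Δpair-split X x y) ⟩
  ∣ (X Δ ⁅ x ⁆) Δ ⁅ y ⁆ ∣ ≡⟨ ∣Δ⁅⁆∣-∉ (X Δ ⁅ x ⁆) y (trans (lookup-Δ⁅⁆-≢ X x≢y) y∉X) ⟩
  suc ∣ X Δ ⁅ x ⁆ ∣       ≡⟨ cong suc (∣Δ⁅⁆∣-∉ X x x∉X) ⟩
  2 + ∣ X ∣               ∎
  where open ≡-Reasoning

∣Δpair∣-∈∈ : (X : Subset n) {x y : Fin n} → x ≢ y → lookup X x ≡ true → lookup X y ≡ true →
             2 + ∣ X Δ pair x y ∣ ≡ ∣ X ∣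
∣Δpair∣-∈∈ X {x} {y} x≢y x∈X y∈X = begin
  2 + ∣ X Δ pair x y ∣         ≡⟨ cong ((2 +_) ∘ ∣_∣) (Δpair-split X x y) ⟩
  2 + ∣ (X Δ ⁅ x ⁆) Δ ⁅ y ⁆ ∣ ≡⟨ cong suc (∣Δ⁅⁆∣-∈ (X Δ ⁅ x ⁆) y (trans (lookup-Δ⁅⁆-≢ X x≢y) y∈X)) ⟩
  suc ∣ X Δ ⁅ x ⁆ ∣           ≡⟨ ∣Δ⁅⁆∣-∈ X x x∈X ⟩
  ∣ X ∣                       ∎
  where open ≡-Reasoning

∣Δpair∣-∉∈ : (X : Subset n) {x y : Fin n} → lookup X x ≡ false → lookup X y ≡ true →
             ∣ X Δ pair x y ∣ ≡ ∣ X ∣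
∣Δpair∣-∉∈ X {x} {y} x∉X y∈X = suc-injective (begin
  suc ∣ X Δ pair x y ∣         ≡⟨ cong (suc ∘ ∣_∣) (Δpair-split X x y) ⟩
  suc ∣ (X Δ ⁅ x ⁆) Δ ⁅ y ⁆ ∣ ≡⟨ ∣Δ⁅⁆∣-∈ (X Δ ⁅ x ⁆) y (trans (lookup-Δ⁅⁆-≢ X (∉-∈⇒≢ X x∉X y∈X)) y∈X) ⟩
  ∣ X Δ ⁅ x ⁆ ∣               ≡⟨ ∣Δ⁅⁆∣-∉ X x x∉X ⟩
  suc ∣ X ∣                   ∎)
  where open ≡-Reasoning

∣Δpair∣-≤ : (X : Subset n) {x y : Fin n} → x ≢ y → lookup X x ≡ true → ∣ X Δ pair x y ∣ ≤ ∣ X ∣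
∣Δpair∣-≤ X {x} {y} x≢y x∈X with lookup X y in y∈X
... | true  = ≤-trans (n≤1+n _) (≤-trans (n≤1+n _) (≤-reflexive (∣Δpair∣-∈∈ X x≢y x∈X y∈X)))
... | false = ≤-reflexive (trans (cong (∣_∣ ∘ (X Δ_)) (pair-comm x y)) (∣Δpair∣-∉∈ X y∈X x∈X))

∣Δpair∣-< : (X : Subset n) {x y : Fin n} → x ≢ y → lookup X x ≡ true → lookup X y ≡ true →
            ∣ X Δ pair x y ∣ < ∣ X ∣
∣Δpair∣-< X x≢y x∈X y∈X = ≤-trans (n≤1+n _) (≤-reflexive (∣Δpair∣-∈∈ X x≢y x∈X y∈X))

-- Sums over GF(2)

sumGF2≡sum : (f : Fin n → Bool) → sumGF2 f ≡ sum f
sumGF2≡sum {zero}  f = refl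
sumGF2≡sum {suc n} f = cong (f zero xor_) (sumGF2≡sum (f ∘ suc))

sumGF2-cong : {f g : Fin n → Bool} → (∀ j → f j ≡ g j) → sumGF2 f ≡ sumGF2 g
sumGF2-cong {f = f} {g} f≗g = trans (sumGF2≡sum f) (trans (sum-cong-≗ f≗g) (sym (sumGF2≡sum g)))

sumGF2-zero : sumGF2 {n} (λ _ → false) ≡ false
sumGF2-zero {n} = trans (sumGF2≡sum {n} (λ _ → false)) (sum-replicate-zero n)

sumGF2-xor : (f g : Fin n → Bool) → sumGF2 (λ j → f j xor g j) ≡ sumGF2 f xor sumGF2 g
sumGF2-xor f g = begin
  sumGF2 (λ j → f j xor g j) ≡⟨ sumGF2≡sum (λ j → f j xor g j) ⟩
  sum (λ j → f j xor g j)    ≡⟨ ∑-distrib-+ f g ⟩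
  sum f xor sum g            ≡⟨ cong₂ _xor_ (sumGF2≡sum f) (sumGF2≡sum g) ⟨
  sumGF2 f xor sumGF2 g      ∎
  where open ≡-Reasoning

sumGF2-∧ˡ : (b : Bool) (f : Fin n → Bool) → sumGF2 (λ j → b ∧ f j) ≡ b ∧ sumGF2 f
sumGF2-∧ˡ b f = begin
  sumGF2 (λ j → b ∧ f j) ≡⟨ sumGF2≡sum (λ j → b ∧ f j) ⟩
  sum (λ j → b ∧ f j)    ≡⟨ *-distribˡ-sum b f ⟨
  b ∧ sum f              ≡⟨ cong (b ∧_) (sumGF2≡sum f) ⟨
  b ∧ sumGF2 f           ∎
  where open ≡-Reasoning

sumGF2-comm : (g : Fin n → Fin n → Bool) →
              sumGF2 (λ i → sumGF2 (g i)) ≡ sumGF2 (λ j → sumGF2 (λ i → g i j))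
sumGF2-comm g = begin
  sumGF2 (λ i → sumGF2 (g i))         ≡⟨ sumGF2-cong (λ i → sumGF2≡sum (g i)) ⟩
  sumGF2 (λ i → sum (g i))            ≡⟨ sumGF2≡sum (λ i → sum (g i)) ⟩
  sum (λ i → sum (g i))               ≡⟨ ∑-comm g ⟩
  sum (λ j → sum (λ i → g i j))       ≡⟨ sumGF2≡sum (λ j → sum (λ i → g i j)) ⟨
  sumGF2 (λ j → sum (λ i → g i j))    ≡⟨ sumGF2-cong (λ j → sumGF2≡sum (λ i → g i j)) ⟨
  sumGF2 (λ j → sumGF2 (λ i → g i j)) ∎
  where open ≡-Reasoning

sumGF2-δ : (i : Fin n) (f : Fin n → Bool) → sumGF2 (λ j → δ i j ∧ f j) ≡ f i
sumGF2-δ {suc n} zero    f = trans (cong (f zero xor_) (sumGF2-zero {n})) (xor-identityʳ (f zero))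
sumGF2-δ         (suc i) f = sumGF2-δ i (f ∘ suc)

sumGF2-witness : (f : Fin n → Bool) → sumGF2 f ≡ true → ∃[ j ] f j ≡ true
sumGF2-witness {suc n} f Σf≡true with f zero in f₀
... | true  = zero , f₀
... | false with sumGF2-witness (f ∘ suc) Σf≡true
...   | j , fj = suc j , fj

module _ (X : Subset n) where

  sumOver-cong : {f g : Fin n → Bool} → (∀ j → lookup X j ≡ true → f j ≡ g j) → sumOver X f ≡ sumOver X g
  sumOver-cong {f} {g} f≗g = sumGF2-cong on-X
    where
    on-X : ∀ j → lookup X j ∧ f j ≡ lookup X j ∧ g j
    on-X j with lookup X j in j∈X
    ... | true  = f≗g j j∈X
    ... | false = refl

  sumOver-xor : (f g : Fin n → Bool) → sumOver X (λ j → f j xor g j) ≡ sumOver X f xor sumOver X g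
  sumOver-xor f g = trans (sumGF2-cong (λ j → ∧-distribˡ-xor (lookup X j) (f j) (g j)))
                          (sumGF2-xor (λ j → lookup X j ∧ f j) (λ j → lookup X j ∧ g j))

  sumOver-∧ˡ : (b : Bool) (f : Fin n → Bool) → sumOver X (λ j → b ∧ f j) ≡ b ∧ sumOver X f
  sumOver-∧ˡ b f = trans (sumGF2-cong (λ j → ∧-left-comm (lookup X j) b (f j)))
                         (sumGF2-∧ˡ b (λ j → lookup X j ∧ f j))

  sumOver-zero : sumOver X (λ _ → false) ≡ false
  sumOver-zero = trans (sumGF2-cong (λ j → ∧-zeroʳ (lookup X j))) (sumGF2-zero {n})

  sumOver-δ : (i : Fin n) (f : Fin n → Bool) → sumOver X (λ j → δ i j ∧ f j) ≡ lookup X i ∧ f i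
  sumOver-δ i f = trans (sumGF2-cong (λ j → ∧-left-comm (lookup X j) (δ i j) (f j)))
                        (sumGF2-δ i (λ j → lookup X j ∧ f j))

  sumOver-δ′ : (k : Fin n) (f : Fin n → Bool) → sumOver X (λ j → f j ∧ δ j k) ≡ lookup X k ∧ f k
  sumOver-δ′ k f = trans (sumOver-cong (λ j _ → trans (∧-comm (f j) (δ j k)) (cong (_∧ f j) (δ-sym j k))))
                         (sumOver-δ k f)

  sumOver-witness : (f : Fin n → Bool) → sumOver X f ≡ true → ∃[ j ] lookup X j ≡ true × f j ≡ true
  sumOver-witness f ΣXf≡true with sumGF2-witness (λ j → lookup X j ∧ f j) ΣXf≡true
  ... | j , j∈X∧fj = j , ∧-≡true j∈X∧fj

  sumOver-comm : (g : Fin n → Fin n → Bool) →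
                 sumOver X (λ i → sumOver X (g i)) ≡ sumOver X (λ j → sumOver X (λ i → g i j))
  sumOver-comm g = begin
    sumOver X (λ i → sumOver X (g i))
      ≡⟨ sumGF2-cong (λ i → sumOver-∧ˡ (x i) (g i)) ⟨
    sumGF2 (λ i → sumGF2 (λ j → x j ∧ (x i ∧ g i j)))
      ≡⟨ sumGF2-comm (λ i j → x j ∧ (x i ∧ g i j)) ⟩
    sumGF2 (λ j → sumGF2 (λ i → x j ∧ (x i ∧ g i j)))
      ≡⟨ sumGF2-cong (λ j → sumGF2-cong (λ i → ∧-left-comm (x j) (x i) (g i j))) ⟩
    sumGF2 (λ j → sumGF2 (λ i → x i ∧ (x j ∧ g i j)))
      ≡⟨ sumGF2-cong (λ j → sumOver-∧ˡ (x j) (λ i → g i j)) ⟩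
    sumOver X (λ j → sumOver X (λ i → g i j))
      ∎
    where
    open ≡-Reasoning
    x : Fin n → Bool
    x = lookup X

  sumOver-assoc : (f : Fin n → Bool) (G : Matrix n) (h : Fin n → Bool) →
                  sumOver X (λ i → sumOver X (λ j → f j ∧ G j i) ∧ h i) ≡
                  sumOver X (λ j → f j ∧ sumOver X (λ i → G j i ∧ h i))
  sumOver-assoc f G h = begin
    sumOver X (λ i → sumOver X (λ j → f j ∧ G j i) ∧ h i)   ≡⟨ sumOver-cong (λ i _ → pull-in i) ⟩
    sumOver X (λ i → sumOver X (λ j → h i ∧ (f j ∧ G j i))) ≡⟨ sumOver-comm (λ i j → h i ∧ (f j ∧ G j i)) ⟩
    sumOver X (λ j → sumOver X (λ i → h i ∧ (f j ∧ G j i))) ≡⟨ sumOver-cong (λ j _ → pull-out j) ⟩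
    sumOver X (λ j → f j ∧ sumOver X (λ i → G j i ∧ h i))   ∎
    where
    open ≡-Reasoning
    pull-in : ∀ i → sumOver X (λ j → f j ∧ G j i) ∧ h i ≡ sumOver X (λ j → h i ∧ (f j ∧ G j i))
    pull-in i = trans (∧-comm _ (h i)) (sym (sumOver-∧ˡ (h i) (λ j → f j ∧ G j i)))
    pull-out : ∀ j → sumOver X (λ i → h i ∧ (f j ∧ G j i)) ≡ f j ∧ sumOver X (λ i → G j i ∧ h i)
    pull-out j = trans (sumOver-cong (λ i _ → ∧-rotate (h i) (f j) (G j i)))
                       (sumOver-∧ˡ (f j) (λ i → G j i ∧ h i))

sumOver-Δ : (X Y : Subset n) (f : Fin n → Bool) → sumOver (X Δ Y) f ≡ sumOver X f xor sumOver Y f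
sumOver-Δ X Y f = trans (sumGF2-cong distrib) (sumGF2-xor (λ j → lookup X j ∧ f j) (λ j → lookup Y j ∧ f j))
  where
  distrib : ∀ j → lookup (X Δ Y) j ∧ f j ≡ (lookup X j ∧ f j) xor (lookup Y j ∧ f j)
  distrib j = trans (cong (_∧ f j) (lookup-Δ X Y j)) (∧-distribʳ-xor (f j) (lookup X j) (lookup Y j))

sumOver-⊥ : (f : Fin n → Bool) → sumOver ⊥ f ≡ false
sumOver-⊥ {n} f = trans (sumGF2-cong (λ j → cong (_∧ f j) (lookup-replicate j false))) (sumGF2-zero {n})

sumOver-⁅⁆ : (x : Fin n) (f : Fin n → Bool) → sumOver ⁅ x ⁆ f ≡ f x
sumOver-⁅⁆ x f = trans (sumGF2-cong (λ j → cong (_∧ f j) (lookup-⁅⁆ x j))) (sumGF2-δ x f)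

sumOver-pair : (x y : Fin n) (f : Fin n → Bool) → sumOver (pair x y) f ≡ f x xor f y
sumOver-pair x y f = trans (sumOver-Δ ⁅ x ⁆ ⁅ y ⁆ f) (cong₂ _xor_ (sumOver-⁅⁆ x f) (sumOver-⁅⁆ y f))

-- Matrices of equivalence relations

-- E is the 0/1 matrix of an equivalence relation and `adjacency` the adjacency matrix of the
-- disjoint union of the complete graphs on its classes; sumOver X (λ j → E j v) is the parity of
-- the number of elements of X in the class of v.
module Cluster (E : Matrix n) (E-isEquivalence : IsEquivalence (λ i j → E i j ≡ true)) where

  private module E = IsEquivalence E-isEquivalence

  adjacency : Matrix n
  adjacency i j = E i j xor δ i j

  EvenOnClasses : Subset n → Set
  EvenOnClasses X = ∀ v → sumOver X (λ j → E j v) ≡ false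

  column-cong : ∀ {i j k} → E j k ≡ true → E i j ≡ E i k
  column-cong {i} {j} {k} jk with E i j in ij | E i k in ik
  ... | true  | true  = refl
  ... | false | false = refl
  ... | true  | false = contradiction (trans (sym ik) (E.trans ij jk)) λ ()
  ... | false | true  = contradiction (trans (sym ij) (E.trans ik (E.sym jk))) λ ()

  row-cong : ∀ {i j k} → E i j ≡ true → E i k ≡ E j k
  row-cong {i} {j} {k} ij with E i k in ik | E j k in jk
  ... | true  | true  = refl
  ... | false | false = refl
  ... | true  | false = contradiction (trans (sym jk) (E.trans (E.sym ij) ik)) λ ()
  ... | false | true  = contradiction (trans (sym ik) (E.trans ij jk)) λ ()

  E∧E : ∀ i j k → E i j ∧ E j k ≡ E i k ∧ E j k
  E∧E i j k with E j k in jk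
  ... | true  = trans (∧-identityʳ (E i j)) (trans (column-cong jk) (sym (∧-identityʳ (E i k))))
  ... | false = trans (∧-zeroʳ (E i j)) (sym (∧-zeroʳ (E i k)))

  module _ (X : Subset n) where

    sumOver-E∧E : ∀ i k → sumOver X (λ j → E i j ∧ E j k) ≡ E i k ∧ sumOver X (λ j → E j k)
    sumOver-E∧E i k = trans (sumOver-cong X (λ j _ → E∧E i j k)) (sumOver-∧ˡ X (E i k) (λ j → E j k))

    sumOver-Δpair : ∀ {x y} v → E x y ≡ true →
                    sumOver (X Δ pair x y) (λ j → E j v) ≡ sumOver X (λ j → E j v)
    sumOver-Δpair {x} {y} v xy = begin
      sumOver (X Δ pair x y) (λ j → E j v)     ≡⟨ sumOver-Δ X (pair x y) (λ j → E j v) ⟩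
      s xor sumOver (pair x y) (λ j → E j v)   ≡⟨ cong (s xor_) (sumOver-pair x y (λ j → E j v)) ⟩
      s xor (E x v xor E y v)                  ≡⟨ cong (λ e → s xor (e xor E y v)) (row-cong xy) ⟩
      s xor (E y v xor E y v)                  ≡⟨ cong (s xor_) (xor-same (E y v)) ⟩
      s xor false                              ≡⟨ xor-identityʳ s ⟩
      s                                        ∎
      where
      open ≡-Reasoning
      s : Bool
      s = sumOver X (λ j → E j v)

    class-partner : ∀ {x} → EvenOnClasses X → lookup X x ≡ true →
                    ∃[ y ] y ≢ x × lookup X y ≡ true × E x y ≡ true
    class-partner {x} even x∈X
      with sumOver-witness (X Δ ⁅ x ⁆) (λ j → E j x)
             (trans (sumOver-Δ X ⁅ x ⁆ (λ j → E j x))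
                    (cong₂ _xor_ (even x) (trans (sumOver-⁅⁆ x (λ j → E j x)) E.refl)))
    ... | y , y∈X-x , y∈[x] = y , x≢y ∘ sym , trans (sym (lookup-Δ⁅⁆-≢ X x≢y)) y∈X-x , E.sym y∈[x]
      where
      x≢y : x ≢ y
      x≢y = ∉-∈⇒≢ (X Δ ⁅ x ⁆) (trans (lookup-Δ⁅⁆-self X x) (cong not x∈X)) y∈X-x

    sumOver-adjacency∧ : ∀ i (g : Fin n → Bool) →
      sumOver X (λ j → adjacency i j ∧ g j) ≡ sumOver X (λ j → E i j ∧ g j) xor (lookup X i ∧ g i)
    sumOver-adjacency∧ i g = begin
      sumOver X (λ j → adjacency i j ∧ g j)
        ≡⟨ sumOver-cong X (λ j _ → ∧-distribʳ-xor (g j) (E i j) (δ i j)) ⟩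
      sumOver X (λ j → (E i j ∧ g j) xor (δ i j ∧ g j))
        ≡⟨ sumOver-xor X (λ j → E i j ∧ g j) (λ j → δ i j ∧ g j) ⟩
      sumOver X (λ j → E i j ∧ g j) xor sumOver X (λ j → δ i j ∧ g j)
        ≡⟨ cong (sumOver X (λ j → E i j ∧ g j) xor_) (sumOver-δ X i g) ⟩
      sumOver X (λ j → E i j ∧ g j) xor (lookup X i ∧ g i)
        ∎
      where open ≡-Reasoning

    adjacency-square : EvenOnClasses X → ∀ {i k} → lookup X i ≡ true → lookup X k ≡ true →
                       sumOver X (λ j → adjacency i j ∧ adjacency j k) ≡ δ i k
    adjacency-square even {i} {k} i∈X k∈X = begin
      sumOver X (λ j → adjacency i j ∧ adjacency j k)
        ≡⟨ sumOver-adjacency∧ i (λ j → adjacency j k) ⟩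
      sumOver X (λ j → E i j ∧ adjacency j k) xor (lookup X i ∧ adjacency i k)
        ≡⟨ cong₂ _xor_ row-times-column (cong (_∧ adjacency i k) i∈X) ⟩
      E i k xor (E i k xor δ i k)
        ≡⟨ xor-assoc (E i k) (E i k) (δ i k) ⟨
      (E i k xor E i k) xor δ i k
        ≡⟨ cong (_xor δ i k) (xor-same (E i k)) ⟩
      δ i k
        ∎
      where
      open ≡-Reasoning
      row-times-column : sumOver X (λ j → E i j ∧ adjacency j k) ≡ E i k
      row-times-column = begin
        sumOver X (λ j → E i j ∧ adjacency j k)
          ≡⟨ sumOver-cong X (λ j _ → ∧-distribˡ-xor (E i j) (E j k) (δ j k)) ⟩
        sumOver X (λ j → (E i j ∧ E j k) xor (E i j ∧ δ j k))
          ≡⟨ sumOver-xor X (λ j → E i j ∧ E j k) (λ j → E i j ∧ δ j k) ⟩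
        sumOver X (λ j → E i j ∧ E j k) xor sumOver X (λ j → E i j ∧ δ j k)
          ≡⟨ cong₂ _xor_ (sumOver-E∧E i k) (sumOver-δ′ X k (E i)) ⟩
        (E i k ∧ sumOver X (λ j → E j k)) xor (lookup X k ∧ E i k)
          ≡⟨ cong₂ (λ s t → (E i k ∧ s) xor (t ∧ E i k)) (even k) k∈X ⟩
        (E i k ∧ false) xor E i k
          ≡⟨ cong (_xor E i k) (∧-zeroʳ (E i k)) ⟩
        E i k
          ∎

    adjacency-kernel : ∀ {v i} → sumOver X (λ j → E j v) ≡ true → lookup X i ≡ true →
                       sumOver X (λ j → adjacency i j ∧ E j v) ≡ false
    adjacency-kernel {v} {i} odd i∈X = begin
      sumOver X (λ j → adjacency i j ∧ E j v)
        ≡⟨ sumOver-adjacency∧ i (λ j → E j v) ⟩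
      sumOver X (λ j → E i j ∧ E j v) xor (lookup X i ∧ E i v)
        ≡⟨ cong₂ _xor_ (sumOver-E∧E i v) (cong (_∧ E i v) i∈X) ⟩
      (E i v ∧ sumOver X (λ j → E j v)) xor E i v
        ≡⟨ cong (λ s → (E i v ∧ s) xor E i v) odd ⟩
      (E i v ∧ true) xor E i v
        ≡⟨ cong (_xor E i v) (∧-identityʳ (E i v)) ⟩
      E i v xor E i v
        ≡⟨ xor-same (E i v) ⟩
      false
        ∎
      where open ≡-Reasoning

    evenOnClasses⇒invertible : EvenOnClasses X → PrincipalInvertible adjacency X
    evenOnClasses⇒invertible even = adjacency , square , square
      where
      square : ∀ i k → i ∈ X → k ∈ X → sumOver X (λ j → adjacency i j ∧ adjacency j k) ≡ δ i k
      square i k i∈X k∈X = adjacency-square even ([]=⇒lookup i∈X) ([]=⇒lookup k∈X)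

    -- If the class of v met X oddly, column v of E restricted to X would be a nonzero kernel vector
    -- of adjacency[X].
    invertible⇒evenOnClasses : PrincipalInvertible adjacency X → EvenOnClasses X
    invertible⇒evenOnClasses (B , _ , B·A≡I) v with sumOver X (λ j → E j v) in odd
    ... | false = refl
    ... | true with sumOver-witness X (λ j → E j v) odd
    ...   | k , k∈X , k∈[v] = contradiction true≡false λ ()
      where
      open ≡-Reasoning
      true≡false : true ≡ false
      true≡false = begin
        true
          ≡⟨ k∈[v] ⟨
        E k v
          ≡⟨ cong (_∧ E k v) k∈X ⟨
        lookup X k ∧ E k v
          ≡⟨ sumOver-δ X k (λ i → E i v) ⟨
        sumOver X (λ i → δ k i ∧ E i v)
          ≡⟨ sumOver-cong X (λ i i∈X → cong (_∧ E i v) (B·A≡I k i (lookup⇒[]= k X k∈X) (lookup⇒[]= i X i∈X))) ⟨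
        sumOver X (λ i → sumOver X (λ j → B k j ∧ adjacency j i) ∧ E i v)
          ≡⟨ sumOver-assoc X (B k) adjacency (λ i → E i v) ⟩
        sumOver X (λ j → B k j ∧ sumOver X (λ i → adjacency j i ∧ E i v))
          ≡⟨ sumOver-cong X (λ j j∈X → trans (cong (B k j ∧_) (adjacency-kernel odd j∈X)) (∧-zeroʳ (B k j))) ⟩
        sumOver X (λ _ → false)
          ≡⟨ sumOver-zero X ⟩
        false
          ∎

-- Largest and smallest feasible sets

∈-allSubsets : (X : Subset n) → X ∈ₗ allSubsets n
∈-allSubsets {zero}  []          = Any.here refl
∈-allSubsets {suc n} (true  ∷ X) = ∈-++⁺ˡ (∈-map⁺ (true ∷_) (∈-allSubsets X))
∈-allSubsets {suc n} (false ∷ X) = ∈-++⁺ʳ (map (true ∷_) (allSubsets n)) (∈-map⁺ (false ∷_) (∈-allSubsets X))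

module _ (F : SetSystem n) where

  private
    feasibleSizesIn : List (Subset n) → List ℕ
    feasibleSizesIn = foldr (λ X r → if F X then ∣ X ∣ ∷ r else r) []

    feasibleSizesIn-complete : ∀ {X} L → X ∈ₗ L → Feasible F X → ∣ X ∣ ∈ₗ feasibleSizesIn L
    feasibleSizesIn-complete (X ∷ L) (Any.here refl) fX rewrite fX = Any.here refl
    feasibleSizesIn-complete (Y ∷ L) (Any.there X∈L) fX with F Y
    ... | true  = Any.there (feasibleSizesIn-complete L X∈L fX)
    ... | false = feasibleSizesIn-complete L X∈L fX

    feasibleSizesIn-sound : ∀ {k} L → k ∈ₗ feasibleSizesIn L → ∃[ X ] Feasible F X × ∣ X ∣ ≡ k
    feasibleSizesIn-sound (Y ∷ L) k∈ with F Y in fY | k∈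
    ... | true  | Any.here k≡∣Y∣ = Y , fY , sym k≡∣Y∣
    ... | true  | Any.there k∈′ = feasibleSizesIn-sound L k∈′
    ... | false | k∈′            = feasibleSizesIn-sound L k∈′

    ∈-feasibleSizes : ∀ {X} → Feasible F X → ∣ X ∣ ∈ₗ feasibleSizes F
    ∈-feasibleSizes {X} = feasibleSizesIn-complete (allSubsets n) (∈-allSubsets X)

  maxSize-ub : ∀ {X} → Feasible F X → ∣ X ∣ ≤ maxSize F
  maxSize-ub fX = foldr-preservesᵒ (λ x y → [ m≤n⇒m≤n⊔o y , m≤n⇒m≤o⊔n x ]) 0 (feasibleSizes F)
                    (inj₂ (Any.map ≤-reflexive (∈-feasibleSizes fX)))

  minSize-lb : ∀ {X} → Feasible F X → minSize F ≤ ∣ X ∣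
  minSize-lb fX = foldr-preservesᵒ (λ x y → [ m≤n⇒m⊓o≤n y , m≤n⇒o⊓m≤n x ]) n (feasibleSizes F)
                    (inj₂ (Any.map (≤-reflexive ∘ sym) (∈-feasibleSizes fX)))

  maxSize-attained : ∀ {X} → Feasible F X → ∃[ Y ] Feasible F Y × ∣ Y ∣ ≡ maxSize F
  maxSize-attained {X} fX with foldr-selective ⊔-sel 0 (feasibleSizes F)
  ... | inj₁ max≡0 = X , fX , trans (n≤0⇒n≡0 (≤-trans (maxSize-ub fX) (≤-reflexive max≡0))) (sym max≡0)
  ... | inj₂ max∈  = feasibleSizesIn-sound (allSubsets n) max∈

  minSize-attained : ∀ {X} → Feasible F X → ∃[ Y ] Feasible F Y × ∣ Y ∣ ≡ minSize F
  minSize-attained {X} fX with foldr-selective ⊓-sel n (feasibleSizes F)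
  ... | inj₁ min≡n = X , fX , ≤-antisym (≤-trans (∣p∣≤n X) (≤-reflexive (sym min≡n))) (minSize-lb fX)
  ... | inj₂ min∈  = feasibleSizesIn-sound (allSubsets n) min∈

  width≡maxSize : Feasible F ⊥ → width F ≡ maxSize F
  width≡maxSize f⊥ = cong (maxSize F ∸_) (n≤0⇒n≡0 (≤-trans (minSize-lb f⊥) (≤-reflexive (∣⊥∣≡0 n))))

2+n≰n : ∀ {m} → 2 + m ≰ m
2+n≰n = 1+n≰n ∘ ≤-trans (n≤1+n _)

parity-suc : ∀ m → parity (suc m) ≡ parity m ⁻¹
parity-suc m = +-homo-+ 1 m

parity-%2 : ∀ m → parity (m % 2) ≡ parity m
parity-%2 zero          = refl
parity-%2 (suc zero)    = refl
parity-%2 (suc (suc m)) = parity-%2 m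

parity-∣Δ∣ : (X Y : Subset n) → parity ∣ X Δ Y ∣ ≡ parity ∣ X ∣ +ℙ parity ∣ Y ∣
parity-∣Δ∣ []          []          = refl
parity-∣Δ∣ (false ∷ X) (false ∷ Y) = parity-∣Δ∣ X Y
parity-∣Δ∣ (false ∷ X) (true  ∷ Y) = begin
  parity (suc ∣ X Δ Y ∣)                  ≡⟨ parity-suc ∣ X Δ Y ∣ ⟩
  (parity ∣ X Δ Y ∣) ⁻¹                   ≡⟨ cong _⁻¹ (parity-∣Δ∣ X Y) ⟩
  (parity ∣ X ∣ +ℙ parity ∣ Y ∣) ⁻¹        ≡⟨ flip-right (parity ∣ X ∣) (parity ∣ Y ∣) ⟩
  parity ∣ X ∣ +ℙ (parity ∣ Y ∣) ⁻¹        ≡⟨ cong (parity ∣ X ∣ +ℙ_) (parity-suc ∣ Y ∣) ⟨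
  parity ∣ X ∣ +ℙ parity (suc ∣ Y ∣)       ∎
  where
  open ≡-Reasoning
  flip-right : ∀ p q → (p +ℙ q) ⁻¹ ≡ p +ℙ q ⁻¹
  flip-right 0ℙ q = refl
  flip-right 1ℙ q = refl
parity-∣Δ∣ (true ∷ X) (false ∷ Y) = begin
  parity (suc ∣ X Δ Y ∣)                  ≡⟨ parity-suc ∣ X Δ Y ∣ ⟩
  (parity ∣ X Δ Y ∣) ⁻¹                   ≡⟨ cong _⁻¹ (parity-∣Δ∣ X Y) ⟩
  (parity ∣ X ∣ +ℙ parity ∣ Y ∣) ⁻¹        ≡⟨ flip-left (parity ∣ X ∣) (parity ∣ Y ∣) ⟩
  (parity ∣ X ∣) ⁻¹ +ℙ parity ∣ Y ∣        ≡⟨ cong (_+ℙ parity ∣ Y ∣) (parity-suc ∣ X ∣) ⟨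
  parity (suc ∣ X ∣) +ℙ parity ∣ Y ∣       ∎
  where
  open ≡-Reasoning
  flip-left : ∀ p q → (p +ℙ q) ⁻¹ ≡ p ⁻¹ +ℙ q
  flip-left 0ℙ q = refl
  flip-left 1ℙ q = ⁻¹-involutive q
parity-∣Δ∣ (true ∷ X) (true ∷ Y) = begin
  parity ∣ X Δ Y ∣                        ≡⟨ parity-∣Δ∣ X Y ⟩
  parity ∣ X ∣ +ℙ parity ∣ Y ∣             ≡⟨ flip-both (parity ∣ X ∣) (parity ∣ Y ∣) ⟩
  (parity ∣ X ∣) ⁻¹ +ℙ (parity ∣ Y ∣) ⁻¹   ≡⟨ cong₂ _+ℙ_ (parity-suc ∣ X ∣) (parity-suc ∣ Y ∣) ⟨
  parity (suc ∣ X ∣) +ℙ parity (suc ∣ Y ∣) ∎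
  where
  open ≡-Reasoning
  flip-both : ∀ p q → p +ℙ q ≡ p ⁻¹ +ℙ q ⁻¹
  flip-both 0ℙ q = sym (⁻¹-involutive q)
  flip-both 1ℙ q = refl

parity-squeeze : ∀ {m k} → parity m ≡ parity k → m ≤ k → k < 2 + m → m ≡ k
parity-squeeze {m} {k} same m≤k k<2+m with m≤n⇒m<n∨m≡n m≤k
... | inj₂ m≡k = m≡k
... | inj₁ m<k = contradiction (trans same (trans (cong parity k≡1+m) (parity-suc m))) (p≢p⁻¹ (parity m))
  where
  k≡1+m : k ≡ suc m
  k≡1+m = ≤-antisym (≤-pred k<2+m) m<k

EvenDistances : SetSystem n → Set
EvenDistances F = ∀ {X Y} → Feasible F X → Feasible F Y → parity ∣ X Δ Y ∣ ≡ 0ℙ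

no-neighbour : {F : SetSystem n} → EvenDistances F → ∀ {X} x → Feasible F X → ¬ Feasible F (X Δ ⁅ x ⁆)
no-neighbour even {X} x fX fX′ =
  contradiction (trans (cong parity (sym (trans (cong ∣_∣ (Δ-cancelˡ X ⁅ x ⁆)) (∣⁅x⁆∣≡1 x)))) (even fX fX′)) λ ()

-- Rigid set systems

-- For r = w(D): the largest distance |W Δ A| from a set A to a feasible set W is the largest
-- size in D ⋆ A, i.e. r + min |X Δ A| over feasible X. This is r for feasible A and more than r
-- otherwise, which `diameter` and `escape` record.
record Rigid (F : SetSystem n) (r : ℕ) : Set where
  field
    ∅-feasible    : Feasible F ⊥
    even-distance : EvenDistances F
    exchange      : ∀ {X Y x} → Feasible F X → Feasible F Y → lookup (X Δ Y) x ≡ true →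
                    ∃[ y ] y ≢ x × lookup (X Δ Y) y ≡ true × Feasible F (X Δ pair x y)
    diameter      : ∀ {X Y} → Feasible F X → Feasible F Y → ∣ X Δ Y ∣ ≤ r
    escape        : ∀ {A} → ¬ Feasible F A → ∃[ W ] Feasible F W × r < ∣ W Δ A ∣

module _ {F : SetSystem n} (dm : IsDeltaMatroid F) (even : IsEven F) (∅-feasible : Feasible F ⊥)
         (width-invariant : (A : Subset n) → width F ≡ width (twist F A)) where

  private
    even-distance : EvenDistances F
    even-distance {X} {Y} fX fY = begin
      parity ∣ X Δ Y ∣              ≡⟨ parity-∣Δ∣ X Y ⟩
      parity ∣ X ∣ +ℙ parity ∣ Y ∣   ≡⟨ cong (_+ℙ parity ∣ Y ∣) same-parity ⟩
      parity ∣ Y ∣ +ℙ parity ∣ Y ∣   ≡⟨ p+p≡0ℙ (parity ∣ Y ∣) ⟩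
      0ℙ                            ∎
      where
      open ≡-Reasoning
      same-parity : parity ∣ X ∣ ≡ parity ∣ Y ∣
      same-parity = trans (sym (parity-%2 ∣ X ∣)) (trans (cong parity (even X Y fX fY)) (parity-%2 ∣ Y ∣))

    exchange : ∀ {X Y x} → Feasible F X → Feasible F Y → lookup (X Δ Y) x ≡ true →
               ∃[ y ] y ≢ x × lookup (X Δ Y) y ≡ true × Feasible F (X Δ pair x y)
    exchange {X} {Y} {x} fX fY x∈ with proj₂ dm X Y fX fY x (lookup⇒[]= x (X Δ Y) x∈)
    ... | y , y∈ , fX′ with x ≟ y
    ...   | yes refl =
      contradiction (subst (Feasible F ∘ (X Δ_)) (∪-idem ⁅ x ⁆) fX′) (no-neighbour {F = F} even-distance x fX)
    ...   | no x≢y   = y , x≢y ∘ sym , []=⇒lookup y∈ , subst (Feasible F ∘ (X Δ_)) (⁅⁆∪⁅⁆≡pair x≢y) fX′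

    maxSize-twist : ∀ {A} → Feasible F A → maxSize (twist F A) ≡ maxSize F
    maxSize-twist {A} fA = begin
      maxSize (twist F A) ≡⟨ width≡maxSize (twist F A) (subst (Feasible F) (sym (Δ-identityʳ A)) fA) ⟨
      width (twist F A)   ≡⟨ width-invariant A ⟨
      width F             ≡⟨ width≡maxSize F ∅-feasible ⟩
      maxSize F           ∎
      where open ≡-Reasoning

    diameter : ∀ {X Y} → Feasible F X → Feasible F Y → ∣ X Δ Y ∣ ≤ maxSize F
    diameter {X} {Y} fX fY = ≤-trans (maxSize-ub (twist F X) (subst (Feasible F) (sym (Δ-cancelˡ X Y)) fY))
                                     (≤-reflexive (maxSize-twist fX))

    escape : ∀ {A} → ¬ Feasible F A → ∃[ W ] Feasible F W × maxSize F < ∣ W Δ A ∣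
    escape {A} ¬fA =
      let Y , fY , ∣Y∣≡max = maxSize-attained G A∈G
      in  A Δ Y , fY , subst (maxSize F <_) (trans (sym ∣Y∣≡max) (cong ∣_∣ (sym (ΔA-cancel Y)))) r<max
      where
      G : SetSystem n
      G = twist F A
      A∈G : Feasible G A
      A∈G = subst (Feasible F) (sym (Δ-self A)) ∅-feasible
      ΔA-cancel : ∀ Y → (A Δ Y) Δ A ≡ Y
      ΔA-cancel Y = trans (cong (_Δ A) (Δ-comm A Y)) (Δ-cancelʳ Y A)
      1≤min : 1 ≤ minSize G
      1≤min with minSize-attained G A∈G
      ... | Z , fZ , ∣Z∣≡min with element-or-empty Z
      ...   | inj₁ (z , z∈Z) = ≤-trans (s≤s z≤n) (≤-trans (≤-reflexive (∣Δ⁅⁆∣-∈ Z z z∈Z)) (≤-reflexive ∣Z∣≡min))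
      ...   | inj₂ refl      = contradiction fZ (¬fA ∘ subst (Feasible F) (Δ-identityʳ A))
      r<max : maxSize F < maxSize G
      r<max = subst (_< maxSize G) (trans (sym (width-invariant A)) (width≡maxSize F ∅-feasible))
                (∸-monoʳ-< 1≤min (≤-trans (minSize-lb G A∈G) (maxSize-ub G A∈G)))

  rigid : Rigid F (maxSize F)
  rigid = record
    { ∅-feasible    = ∅-feasible
    ; even-distance = even-distance
    ; exchange      = exchange
    ; diameter      = diameter
    ; escape        = escape
    }

Rigid-twist : {F : SetSystem n} {r : ℕ} {A : Subset n} → Rigid F r → Feasible F A → Rigid (twist F A) r
Rigid-twist {F = F} {r} {A} R fA = record
  { ∅-feasible    = subst (Feasible F) (sym (Δ-identityʳ A)) fA
  ; even-distance = λ {X} {Y} fX fY → subst (λ Z → parity ∣ Z ∣ ≡ 0ℙ) (Δ-translate A X Y) (even-distance fX fY)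
  ; exchange      = exchange′
  ; diameter      = λ {X} {Y} fX fY → subst (λ Z → ∣ Z ∣ ≤ r) (Δ-translate A X Y) (diameter fX fY)
  ; escape        = escape′
  }
  where
  open Rigid R
  exchange′ : ∀ {X Y x} → Feasible F (A Δ X) → Feasible F (A Δ Y) → lookup (X Δ Y) x ≡ true →
              ∃[ y ] y ≢ x × lookup (X Δ Y) y ≡ true × Feasible F (A Δ (X Δ pair x y))
  exchange′ {X} {Y} fX fY x∈ with exchange fX fY (subst (λ Z → lookup Z _ ≡ true) (sym (Δ-translate A X Y)) x∈)
  ... | y , y≢x , y∈ , fX′ = y , y≢x , subst (λ Z → lookup Z y ≡ true) (Δ-translate A X Y) y∈ ,
                             subst (Feasible F) (Δ-assoc A X (pair _ y)) fX′
  escape′ : ∀ {B} → ¬ Feasible F (A Δ B) → ∃[ W ] Feasible F (A Δ W) × r < ∣ W Δ B ∣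
  escape′ {B} ¬fB with escape ¬fB
  ... | W , fW , far = A Δ W , subst (Feasible F) (sym (Δ-cancelˡ A W)) fW , subst (λ Z → r < ∣ Z ∣) rearrange far
    where
    rearrange : W Δ (A Δ B) ≡ (A Δ W) Δ B
    rearrange = trans (sym (Δ-assoc W A B)) (cong (_Δ B) (Δ-comm W A))

-- Feasible pairs

module _ {F : SetSystem n} {r : ℕ} (R : Rigid F r) where

  open Rigid R

  size≤r : ∀ {X} → Feasible F X → ∣ X ∣ ≤ r
  size≤r {X} fX = subst (_≤ r) (cong ∣_∣ (Δ-identityʳ X)) (diameter fX ∅-feasible)

  pair-sym : ∀ {x y} → Feasible F (pair x y) → Feasible F (pair y x)
  pair-sym {x} {y} = subst (Feasible F) (pair-comm x y)

  even-size : ∀ {X} → Feasible F X → parity ∣ X ∣ ≡ 0ℙ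
  even-size {X} fX = subst (λ Z → parity ∣ Z ∣ ≡ 0ℙ) (Δ-identityʳ X) (even-distance fX ∅-feasible)

  singleton-infeasible : ∀ b → ¬ Feasible F ⁅ b ⁆
  singleton-infeasible b =
    no-neighbour {F = F} even-distance b ∅-feasible ∘ subst (Feasible F) (sym (Δ-identityˡ ⁅ b ⁆))

  partner : ∀ {S z} → Feasible F S → lookup S z ≡ true →
            ∃[ y ] y ≢ z × lookup S y ≡ true × Feasible F (pair z y)
  partner {S} {z} fS z∈S with exchange ∅-feasible fS (subst (λ Z → lookup Z z ≡ true) (sym (Δ-identityˡ S)) z∈S)
  ... | y , y≢z , y∈ , f = y , y≢z , subst (λ Z → lookup Z y ≡ true) (Δ-identityˡ S) y∈ ,
                           subst (Feasible F) (Δ-identityˡ (pair z y)) f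

  peel : ∀ {X x} → Feasible F X → lookup X x ≡ true →
         ∃[ y ] y ≢ x × lookup X y ≡ true × Feasible F (X Δ pair x y)
  peel {X} {x} fX x∈X with exchange fX ∅-feasible (subst (λ Z → lookup Z x ≡ true) (sym (Δ-identityʳ X)) x∈X)
  ... | y , y≢x , y∈ , f = y , y≢x , subst (λ Z → lookup Z y ≡ true) (Δ-identityʳ X) y∈ , f

  pair-meets-top : ∀ {X x y} → Feasible F X → ∣ X ∣ ≡ r → x ≢ y → lookup X x ≡ false → lookup X y ≡ false →
                   ¬ Feasible F (pair x y)
  pair-meets-top {X} fX ∣X∣≡r x≢y x∉X y∉X fxy =
    2+n≰n (subst (_≤ r) (trans (∣Δpair∣-∉∉ X x≢y x∉X y∉X) (cong (2 +_) ∣X∣≡r)) (diameter fX fxy))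

  top-exchange : ∀ {V W x} → Feasible F V → ∣ V ∣ ≡ r → Feasible F W → lookup W x ≡ true → lookup V x ≡ false →
                 ∃[ y ] lookup V y ≡ true × lookup W y ≡ false × Feasible F (V Δ pair x y)
  top-exchange {V} {W} {x} fV ∣V∣≡r fW x∈W x∉V with exchange fV fW (trans (lookup-Δ V W x) (cong₂ _xor_ x∉V x∈W))
  ... | y , y≢x , y∈VΔW , fV′ with lookup V y in y∈V
  ...   | true  = y , y∈V , trans (xor≡true⇒≡not (trans (sym (lookup-Δ V W y)) y∈VΔW)) (cong not y∈V) , fV′
  ...   | false =
    contradiction (subst (_≤ r) (trans (∣Δpair∣-∉∉ V (y≢x ∘ sym) x∉V y∈V) (cong (2 +_) ∣V∣≡r)) (size≤r fV′)) 2+n≰n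

  top-avoiding-point : ∀ b → ∃[ U ] Feasible F U × ∣ U ∣ ≡ r × lookup U b ≡ false
  top-avoiding-point b with escape (singleton-infeasible b)
  ... | U , fU , r<∣UΔb∣ with lookup U b in Ub
  ...   | true  =
    contradiction (≤-trans (n≤1+n _) (≤-trans (≤-reflexive (∣Δ⁅⁆∣-∈ U b Ub)) (size≤r fU))) (<⇒≱ r<∣UΔb∣)
  ...   | false = U , fU , ≤-antisym (size≤r fU) (≤-pred (≤-trans r<∣UΔb∣ (≤-reflexive (∣Δ⁅⁆∣-∉ U b Ub)))) , Ub

  top-avoiding-pair : ∀ {a c} → a ≢ c → ¬ Feasible F (pair a c) →
                      ∃[ W ] Feasible F W × ∣ W ∣ ≡ r × lookup W a ≡ false × lookup W c ≡ false
  top-avoiding-pair {a} {c} a≢c ¬fac with escape ¬fac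
  ... | W , fW , r<d = W , fW , ∣W∣≡r , a∉W , c∉W
    where
    not-closer : ∣ W Δ pair a c ∣ ≰ ∣ W ∣
    not-closer d≤∣W∣ = <⇒≱ r<d (≤-trans d≤∣W∣ (size≤r fW))
    a∉W : lookup W a ≡ false
    a∉W = ¬-not (not-closer ∘ ∣Δpair∣-≤ W a≢c)
    c∉W : lookup W c ≡ false
    c∉W = ¬-not (not-closer ∘ subst (λ P → ∣ W Δ P ∣ ≤ ∣ W ∣) (pair-comm c a) ∘ ∣Δpair∣-≤ W (a≢c ∘ sym))
    r-even : parity r ≡ 0ℙ
    r-even = let U , fU , ∣U∣≡r , _ = top-avoiding-point a in trans (cong parity (sym ∣U∣≡r)) (even-size fU)
    ∣W∣≡r : ∣ W ∣ ≡ r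
    ∣W∣≡r = parity-squeeze (trans (even-size fW) (sym r-even)) (size≤r fW)
                           (subst (r <_) (∣Δpair∣-∉∉ W a≢c a∉W c∉W) r<d)

  top-approach : ∀ {W} → Feasible F W → ∀ b {V} → Feasible F V → ∣ V ∣ ≡ r → lookup V b ≡ false →
                 ∃[ V′ ] Feasible F V′ × ∣ V′ ∣ ≡ r × lookup V′ b ≡ false ×
                         (∀ x → lookup W x ≡ true → lookup V′ x ≡ false → x ≡ b)
  top-approach {W} fW b {V} = go V (On.wellFounded distance <-wellFounded V)
    where
    distance : Subset n → ℕ
    distance V = ∣ V Δ W ∣
    go : ∀ V → Acc (_<_ on distance) V → Feasible F V → ∣ V ∣ ≡ r → lookup V b ≡ false →
         ∃[ V′ ] Feasible F V′ × ∣ V′ ∣ ≡ r × lookup V′ b ≡ false ×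
                 (∀ x → lookup W x ≡ true → lookup V′ x ≡ false → x ≡ b)
    go V (acc rec) fV ∣V∣≡r b∉V
      with any? (λ x → ((lookup W x Bool.≟ true) ×-dec (lookup V x Bool.≟ false)) ×-dec ¬? (x ≟ b))
    ... | no none =
      V , fV , ∣V∣≡r , b∉V , λ x x∈W x∉V → decidable-stable (x ≟ b) (λ x≢b → none (x , (x∈W , x∉V) , x≢b))
    ... | yes (x , (x∈W , x∉V) , x≢b) with top-exchange fV ∣V∣≡r fW x∈W x∉V
    ...   | y , y∈V , y∉W , fV′ = go (V Δ pair x y) (rec closer) fV′ (trans (∣Δpair∣-∉∈ V x∉V y∈V) ∣V∣≡r)
                                   (trans (lookup-Δpair-≢ V x≢b y≢b) b∉V)
      where
      x≢y : x ≢ y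
      x≢y = ∉-∈⇒≢ V x∉V y∈V
      y≢b : y ≢ b
      y≢b = ∉-∈⇒≢ V b∉V y∈V ∘ sym
      closer : distance (V Δ pair x y) < distance V
      closer = subst (_< distance V) (cong ∣_∣ (Δ-swapʳ V W (pair x y)))
                 (≤-trans (n≤1+n _) (≤-reflexive (∣Δpair∣-∈∈ (V Δ W) x≢y
                   (trans (lookup-Δ V W x) (cong₂ _xor_ x∉V x∈W)) (trans (lookup-Δ V W y) (cong₂ _xor_ y∈V y∉W)))))

  pair-trans : ∀ {a b c} → Feasible F (pair a b) → Feasible F (pair b c) → Feasible F (pair a c)
  pair-trans {a} {b} {c} fab fbc with a ≟ b | b ≟ c
  ... | yes refl | _        = fbc
  ... | no _     | yes refl = fab
  ... | no a≢b   | no b≢c   = decidable-stable (F (pair a c) Bool.≟ true) ¬¬fac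
    where
    -- W has size r, avoids a and c, so contains b; V has size r, avoids b, so contains a, and
    -- W ∖ V ⊆ {b}. Exchanging a into W can then only remove b, leaving a set of size r avoiding b, c.
    ¬¬fac : ¬ ¬ Feasible F (pair a c)
    ¬¬fac ¬fac =
      let W , fW , ∣W∣≡r , a∉W , c∉W = top-avoiding-pair a≢c ¬fac
          b∈W = ¬-not (λ b∉W → pair-meets-top fW ∣W∣≡r a≢b a∉W b∉W fab)
          U , fU , ∣U∣≡r , b∉U = top-avoiding-point b
          V , fV , ∣V∣≡r , b∉V , W∖V⊆b = top-approach fW b fU ∣U∣≡r b∉U
          a∈V = ¬-not (λ a∉V → pair-meets-top fV ∣V∣≡r a≢b a∉V b∉V fab)
          y , y∈W , y∉V , fW′ = top-exchange fW ∣W∣≡r fV a∈V a∉W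
          fW″ = subst (λ z → Feasible F (W Δ pair a z)) (W∖V⊆b y y∈W y∉V) fW′
      in  pair-meets-top fW″ (trans (∣Δpair∣-∉∈ W a∉W b∈W) ∣W∣≡r) b≢c
                         (trans (lookup-Δpair-snd W a≢b) (cong not b∈W)) (trans (lookup-Δpair-≢ W a≢c b≢c) c∉W) fbc
      where
      a≢c : a ≢ c
      a≢c refl = ¬fac (subst (Feasible F) (sym (pair-self a)) ∅-feasible)

  pair-Δ-cancel : ∀ {a b c d} → c ≢ a → c ≢ b → d ≢ a → d ≢ b → c ≢ d →
                  Feasible F (pair a b) → Feasible F (pair a b Δ pair c d) → Feasible F (pair c d)
  pair-Δ-cancel {a} {b} {c} {d} c≢a c≢b d≢a d≢b c≢d fab fS =
    [ id , (λ fca → [ pair-sym , (λ fda → pair-trans fca (pair-sym fda)) ] d-side) ] c-side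
    where
    S : Subset n
    S = pair a b Δ pair c d
    joins-a : ∀ {z y} → Feasible F (pair z y) → y ≡ a ⊎ y ≡ b → Feasible F (pair z a)
    joins-a fzy (inj₁ refl) = fzy
    joins-a fzy (inj₂ refl) = pair-trans fzy (pair-sym fab)
    c∈S : lookup S c ≡ true
    c∈S = trans (lookup-pairΔpair a b c d c)
                (cong₂ _xor_ (cong₂ _xor_ (δ-≢ (c≢a ∘ sym)) (δ-≢ (c≢b ∘ sym)))
                             (cong₂ _xor_ (δ-refl c) (δ-≢ (c≢d ∘ sym))))
    d∈S : lookup S d ≡ true
    d∈S = trans (lookup-pairΔpair a b c d d)
                (cong₂ _xor_ (cong₂ _xor_ (δ-≢ (d≢a ∘ sym)) (δ-≢ (d≢b ∘ sym)))
                             (cong₂ _xor_ (δ-≢ c≢d) (δ-refl d)))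
    c-side : Feasible F (pair c d) ⊎ Feasible F (pair c a)
    c-side with partner fS c∈S
    ... | y , y≢c , y∈S , fcy with pairΔpair-members y∈S
    ...   | inj₁ y∈ab        = inj₂ (joins-a fcy y∈ab)
    ...   | inj₂ (inj₁ refl) = contradiction refl y≢c
    ...   | inj₂ (inj₂ refl) = inj₁ fcy
    d-side : Feasible F (pair d c) ⊎ Feasible F (pair d a)
    d-side with partner fS d∈S
    ... | y , y≢d , y∈S , fdy with pairΔpair-members y∈S
    ...   | inj₁ y∈ab        = inj₂ (joins-a fdy y∈ab)
    ...   | inj₂ (inj₁ refl) = inj₁ fdy
    ...   | inj₂ (inj₂ refl) = contradiction refl y≢d

module _ {F : SetSystem n} {r : ℕ} (R : Rigid F r) where

  open Rigid R

  pair-Δ-pair : ∀ {a b c d} → Feasible F (pair a b) → Feasible F (pair c d) → Feasible F (pair a b Δ pair c d)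
  pair-Δ-pair {a} {b} {c} {d} fab fcd with c ≟ a | c ≟ b | d ≟ a | d ≟ b | c ≟ d
  ... | yes refl | _        | _        | _        | _        =
    subst (Feasible F) (sym (Δ-translate ⁅ a ⁆ ⁅ b ⁆ ⁅ d ⁆)) (pair-trans R (pair-sym R fab) fcd)
  ... | no _     | yes refl | _        | _        | _        =
    subst (Feasible F) (sym (pair-chain a b d)) (pair-trans R fab fcd)
  ... | no _     | no _     | yes refl | _        | _        =
    subst (Feasible F) (sym (trans (cong (pair a b Δ_) (pair-comm c a)) (Δ-translate ⁅ a ⁆ ⁅ b ⁆ ⁅ c ⁆)))
          (pair-trans R (pair-sym R fab) (pair-sym R fcd))
  ... | no _     | no _     | no _     | yes refl | _        =
    subst (Feasible F) (sym (trans (cong (pair a b Δ_) (pair-comm c b)) (pair-chain a b c)))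
          (pair-trans R fab (pair-sym R fcd))
  ... | no _     | no _     | no _     | no _     | yes refl =
    subst (Feasible F) (sym (trans (cong (pair a b Δ_) (pair-self c)) (Δ-identityʳ (pair a b)))) fab
  ... | no c≢a   | no c≢b   | no d≢a   | no d≢b   | no c≢d   =
    pair-Δ-cancel (Rigid-twist R fab) c≢a c≢b d≢a d≢b c≢d
      (subst (Feasible F) (sym (Δ-self (pair a b))) ∅-feasible)
      (subst (Feasible F) (sym (Δ-cancelˡ (pair a b) (pair c d))) fcd)

module _ {F : SetSystem n} {r : ℕ} (R : Rigid F r) where

  Δ-pair-feasible : ∀ {X a b} → Feasible F X → Feasible F (pair a b) → Feasible F (X Δ pair a b)
  Δ-pair-feasible {X} {a} {b} fX fab = go X (On.wellFounded ∣_∣ <-wellFounded X) fX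
    where
    go : ∀ X → Acc (_<_ on ∣_∣) X → Feasible F X → Feasible F (X Δ pair a b)
    go X (acc rec) fX with element-or-empty X
    ... | inj₂ refl = subst (Feasible F) (sym (Δ-identityˡ (pair a b))) fab
    ... | inj₁ (x , x∈X) with peel R fX x∈X
    ...   | y , y≢x , y∈X , fX′ = subst (Feasible F) regroup (pair-Δ-pair (Rigid-twist R fX′) fxy fab′)
      where
      fxy : Feasible F ((X Δ pair x y) Δ pair x y)
      fxy = subst (Feasible F) (sym (Δ-cancelʳ X (pair x y))) fX
      fab′ : Feasible F ((X Δ pair x y) Δ pair a b)
      fab′ = go (X Δ pair x y) (rec (∣Δpair∣-< X (y≢x ∘ sym) x∈X y∈X)) fX′
      regroup : (X Δ pair x y) Δ (pair x y Δ pair a b) ≡ X Δ pair a b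
      regroup = trans (sym (Δ-assoc (X Δ pair x y) (pair x y) (pair a b)))
                      (cong (_Δ pair a b) (Δ-cancelʳ X (pair x y)))

-- Binary representation

module _ {F : SetSystem n} {r : ℕ} (R : Rigid F r) where

  open Rigid R

  feasiblePair : Matrix n
  feasiblePair i j = F (pair i j)

  feasiblePair-isEquivalence : IsEquivalence (λ i j → feasiblePair i j ≡ true)
  feasiblePair-isEquivalence = record
    { refl  = λ {i} → subst (Feasible F) (sym (pair-self i)) ∅-feasible
    ; sym   = pair-sym R
    ; trans = pair-trans R
    }

  open Cluster feasiblePair feasiblePair-isEquivalence

  feasible⇒evenOnClasses : ∀ {X} → Feasible F X → EvenOnClasses X
  feasible⇒evenOnClasses {X} = go X (On.wellFounded ∣_∣ <-wellFounded X)
    where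
    go : ∀ X → Acc (_<_ on ∣_∣) X → Feasible F X → EvenOnClasses X
    go X (acc rec) fX v with element-or-empty X
    ... | inj₂ refl = sumOver-⊥ (λ j → feasiblePair j v)
    ... | inj₁ (x , x∈X) with partner R fX x∈X
    ...   | y , y≢x , y∈X , fxy = begin
      sumOver X inClass                           ≡⟨ cong (λ Z → sumOver Z inClass) (Δ-cancelʳ X (pair x y)) ⟨
      sumOver ((X Δ pair x y) Δ pair x y) inClass ≡⟨ sumOver-Δpair (X Δ pair x y) v fxy ⟩
      sumOver (X Δ pair x y) inClass              ≡⟨ go (X Δ pair x y) (rec smaller) (Δ-pair-feasible R fX fxy) v ⟩
      false                                       ∎
      where
      open ≡-Reasoning
      inClass : Fin n → Bool
      inClass j = feasiblePair j v
      smaller : ∣ X Δ pair x y ∣ < ∣ X ∣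
      smaller = ∣Δpair∣-< X (y≢x ∘ sym) x∈X y∈X

  evenOnClasses⇒feasible : ∀ {X} → EvenOnClasses X → Feasible F X
  evenOnClasses⇒feasible {X} = go X (On.wellFounded ∣_∣ <-wellFounded X)
    where
    go : ∀ X → Acc (_<_ on ∣_∣) X → EvenOnClasses X → Feasible F X
    go X (acc rec) even with element-or-empty X
    ... | inj₂ refl = ∅-feasible
    ... | inj₁ (x , x∈X) with class-partner X even x∈X
    ...   | y , y≢x , y∈X , fxy =
      subst (Feasible F) (Δ-cancelʳ X (pair x y)) (Δ-pair-feasible R (go (X Δ pair x y) (rec smaller) even′) fxy)
      where
      smaller : ∣ X Δ pair x y ∣ < ∣ X ∣
      smaller = ∣Δpair∣-< X (y≢x ∘ sym) x∈X y∈X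
      even′ : EvenOnClasses (X Δ pair x y)
      even′ v = trans (sumOver-Δpair X v fxy) (even v)

  binary : IsBinary F
  binary = ⊥ , ∅-feasible , adjacency , symmetric , feasible⇒invertible , invertible⇒feasible
    where
    symmetric : IsSymmetric adjacency
    symmetric i j = cong₂ _xor_ (cong F (pair-comm i j)) (δ-sym i j)
    feasible⇒invertible : ∀ X → Feasible F X → PrincipalInvertible adjacency (⊥ Δ X)
    feasible⇒invertible X fX = subst (PrincipalInvertible adjacency) (sym (Δ-identityˡ X))
                                     (evenOnClasses⇒invertible X (feasible⇒evenOnClasses fX))
    invertible⇒feasible : ∀ X → PrincipalInvertible adjacency (⊥ Δ X) → Feasible F X
    invertible⇒feasible X inv = evenOnClasses⇒feasible
      (invertible⇒evenOnClasses X (subst (PrincipalInvertible adjacency) (Δ-identityˡ X) inv))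

mainTheorem6 : ¬ (Σ ℕ λ n → Σ (SetSystem n) λ F →
    IsDeltaMatroid F × IsEven F × ¬ IsBinary F × Feasible F ⊥ ×
    ((A : Subset n) → width F ≡ width (twist F A)))
mainTheorem6 (n , F , dm , even , ¬binary , ∅-feasible , width-invariant) =
  ¬binary (binary (rigid dm even ∅-feasible width-invariant))
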